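{- Let $L=(S,A,\to)$ be a labelled transition system and $x,y\in\{o,b\}$. Then $\underline{\leftrightarrow}_{(x,y)}$ is an equivalence relation on $S$.
   Context: LTS $L=(S,A,\to)$: states $S$, actions $A$ containing the internal action $\tau$, $\to\subseteq S\times A\times S$ written $s\xrightarrow{a}t$; $\twoheadrightarrow$ is the reflexive-transitive closure of $\xrightarrow{\tau}$. For $R\subseteq S\times S$ and $s,s',t\in S$: $s\twoheadrightarrow_{o,R,t}s'$ iff $s\twoheadrightarrow s'$; $s\twoheadrightarrow_{b,R,t}s'$ iff $s\twoheadrightarrow s'$, $t\,R\,s$ and $t\,R\,s'$. For $x,y\in\{o,b\}$ a symmetric relation $R\subseteq S\times S$ is an $(x,y)$-generic bisimulation if whenever $s\,R\,t$ and $s\xrightarrow{a}s'$, either $a=\tau$ and $s'\,R\,t$, or there exist $t_1,t_2,t'$ with $t\twoheadrightarrow_{x,R,s}t_1\xrightarrow{a}t_2\twoheadrightarrow_{y,R,s'}t'$ and $s'\,R\,t'$. $s\,\underline{\leftrightarrow}_{(x,y)}\,t$ iff some $(x,y)$-generic bisimulation relates $s$ and $t$. -}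

module Defs where

open import Level using (0ℓ)
open import Data.Product using (Σ; ∃; _×_; _,_)
open import Data.Sum using (_⊎_)
open import Relation.Binary.PropositionalEquality using (_≡_)
open import Relation.Binary.Core using (Rel)
open import Relation.Binary.Definitions using (Symmetric)
open import Relation.Binary.Construct.Closure.ReflexiveTransitive using (Star)

record LTS : Set₁ where
  field
    State  : Set
    Action : Set
    τ      : Action
    _─[_]→_ : State → Action → State → Set

data Mode : Set where
  o b : Mode

module _ (L : LTS) where
  open LTS L

  _↠_ : State → State → Set
  _↠_ = Star (λ s s' → s ─[ τ ]→ s')

  GenSteps : Mode → Rel State 0ℓ → State → State → State → Set
  GenSteps o R t s s' = s ↠ s'
  GenSteps b R t s s' = (s ↠ s') × R t s × R t s'

  Transfer : Mode → Mode → Rel State 0ℓ → Set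
  Transfer x y R =
    ∀ {s t s' a} → R s t → s ─[ a ]→ s' →
      ((a ≡ τ) × R s' t)
      ⊎ (Σ State λ t₁ → Σ State λ t₂ → Σ State λ t' →
           GenSteps x R s t t₁ × t₁ ─[ a ]→ t₂ × GenSteps y R s' t₂ t' × R s' t')

  IsGenericBisim : Mode → Mode → Rel State 0ℓ → Set
  IsGenericBisim x y R = Symmetric R × Transfer x y R

  GenBisimilar : Mode → Mode → State → State → Set₁
  GenBisimilar x y s t = ∃ λ (R : Rel State 0ℓ) → IsGenericBisim x y R × R s t

-- Composing two bisimulations fails when x or y is b, since the b-modes demand that intermediate
-- states stay related; instead the equivalence closure of their union is a bisimulation. The
-- argument allows the middle step of an answer to be omitted when it is a τ-step: such weak
-- answers propagate along chains of related states, and in an equivalence relation an omitted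
-- τ-step can be traded back for an answer of the original form.
module Submission where

open import Level using (0ℓ)
open import Data.Product using (Σ; _×_; _,_)
open import Data.Sum using (_⊎_; inj₁; inj₂)
open import Relation.Binary.Core using (Rel)
open import Relation.Binary.Definitions using (Symmetric)
open import Relation.Binary.Structures using (IsEquivalence)
open import Relation.Binary.PropositionalEquality as ≡ using (_≡_; refl)
open import Relation.Binary.Construct.Union as Union using (_∪_)
open import Relation.Binary.Construct.Closure.ReflexiveTransitive using (Star; ε; _◅_; _◅◅_; reverse)

open import Defs

module _ (L : LTS) where
  open LTS L

  private variable
    R R′ : Rel State 0ℓ
    s s′ t t′ u u′ v v₀ w w′ : State
    a : Action

  data _─⟨_⟩→_ : State → Action → State → Set where
    step : s ─[ a ]→ s′ → s ─⟨ a ⟩→ s′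
    idle : s ─⟨ τ ⟩→ s

  optional-τ⇒↠ : u ─⟨ τ ⟩→ v → _↠_ L u v
  optional-τ⇒↠ (step st) = st ◅ ε
  optional-τ⇒↠ idle      = ε

  ↠-unsnoc : _↠_ L u v → u ≡ v ⊎ Σ State λ w → _↠_ L u w × w ─[ τ ]→ v
  ↠-unsnoc ε = inj₁ refl
  ↠-unsnoc (st ◅ p) with ↠-unsnoc p
  ... | inj₁ refl           = inj₂ (_ , ε , st)
  ... | inj₂ (w , p′ , st′) = inj₂ (w , st ◅ p′ , st′)

  GenSteps-path : ∀ z → GenSteps L z R u v w → _↠_ L v w
  GenSteps-path o p           = p
  GenSteps-path b (p , _ , _) = p

  GenSteps-refl : ∀ z → R u v → GenSteps L z R u v v
  GenSteps-refl o r = ε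
  GenSteps-refl b r = ε , r , r

  GenSteps-map : ∀ z → (∀ {u v} → R u v → R′ u v) → GenSteps L z R u v w → GenSteps L z R′ u v w
  GenSteps-map o f p            = p
  GenSteps-map b f (p , r , r′) = p , f r , f r′

  GenSteps-prepend : ∀ z → R u v → _↠_ L v v₀ → GenSteps L z R u v₀ w → GenSteps L z R u v w
  GenSteps-prepend o r p q            = p ◅◅ q
  GenSteps-prepend b r p (q , _ , r′) = p ◅◅ q , r , r′

  GenSteps-extend : ∀ z → GenSteps L z R u v w → _↠_ L w w′ → R u w′ → GenSteps L z R u v w′
  GenSteps-extend o p q r            = p ◅◅ q
  GenSteps-extend b (p , r , _) q r′ = p ◅◅ q , r , r′

  GenSteps-reanchor-source : ∀ z → GenSteps L z R u v w′ → GenSteps L z (Star R) v t w →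
                             GenSteps L z (Star R) u t w
  GenSteps-reanchor-source o _ p                      = p
  GenSteps-reanchor-source b (_ , r , _) (p , e , e′) = p , r ◅ e , r ◅ e′

  GenSteps-reanchor-target : ∀ z → GenSteps L z R u v₀ v → GenSteps L z (Star R) v t w →
                             GenSteps L z (Star R) u t w
  GenSteps-reanchor-target o _ p                      = p
  GenSteps-reanchor-target b (_ , _ , r) (p , e , e′) = p , r ◅ e , r ◅ e′

  Response : (State → Action → State → Set) → Mode → Mode → Rel State 0ℓ →
             State → State → Action → State → Set
  Response _⟶[_]_ x y R s t a s′ =
    Σ State λ t₁ → Σ State λ t₂ → Σ State λ t′ →
      GenSteps L x R s t t₁ × t₁ ⟶[ a ] t₂ × GenSteps L y R s′ t₂ t′ × R s′ t′

  -- Only here must R be an equivalence: in the b-modes, s′ R t is reached through u.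
  stuttering-response : ∀ x y → IsEquivalence R → R s t →
    GenSteps L x R s t u → GenSteps L y R s′ u t′ → R s′ t′ →
    R s′ t ⊎ Response _─[_]→_ x y R s t τ s′
  stuttering-response o o _ _ p q r′ with p ◅◅ q
  ... | ε       = inj₁ r′
  ... | st ◅ q′ = inj₂ (_ , _ , _ , ε , st , q′ , r′)
  stuttering-response b o eq r (_ , _ , r₁) ε r′ = inj₁ (trans r′ (trans (sym r₁) r))
    where open IsEquivalence eq
  stuttering-response b o _ _ g (st ◅ q) r′ = inj₂ (_ , _ , _ , g , st , q , r′)
  stuttering-response o b _ _ p g r′ with ↠-unsnoc p | g
  ... | inj₁ refl          | (_ , r₁ , _) = inj₁ r₁
  ... | inj₂ (w , p′ , st) | _            = inj₂ (w , _ , _ , p′ , st , g , r′)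
  stuttering-response b b eq r (_ , _ , r₁) (_ , r₂ , _) _ = inj₁ (trans r₂ (trans (sym r₁) r))
    where open IsEquivalence eq

  module _ (x y : Mode) where

    WeakResponse : Rel State 0ℓ → State → State → Action → State → Set
    WeakResponse = Response _─⟨_⟩→_ x y

    WeakTransfer : Rel State 0ℓ → Set
    WeakTransfer R = ∀ {s t s′ a} → R s t → s ─⟨ a ⟩→ s′ → WeakResponse R s t a s′

    immediate-response : R s t → t ─⟨ a ⟩→ t′ → R s′ t′ → WeakResponse R s t a s′
    immediate-response r st r′ = _ , _ , _ , GenSteps-refl x r , st , GenSteps-refl y r′ , r′

    WeakResponse-map : (∀ {u v} → R u v → R′ u v) → WeakResponse R s t a s′ → WeakResponse R′ s t a s′
    WeakResponse-map f (t₁ , t₂ , t′ , g , st , g′ , r′) =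
      t₁ , t₂ , t′ , GenSteps-map x f g , st , GenSteps-map y f g′ , f r′

    Transfer⇒WeakTransfer : Transfer L x y R → WeakTransfer R
    Transfer⇒WeakTransfer tr r idle = immediate-response r idle r
    Transfer⇒WeakTransfer tr r (step st) with tr r st
    ... | inj₁ (refl , r′)                        = immediate-response r idle r′
    ... | inj₂ (t₁ , t₂ , t′ , g , st′ , g′ , r′) = t₁ , t₂ , t′ , g , step st′ , g′ , r′

    WeakTransfer⇒Transfer : IsEquivalence R → WeakTransfer R → Transfer L x y R
    WeakTransfer⇒Transfer eq wtr r st with wtr r (step st)
    ... | t₁ , t₂ , t′ , g , step st′ , g′ , r′ = inj₂ (t₁ , t₂ , t′ , g , st′ , g′ , r′)
    ... | _ , _ , _ , g , idle , g′ , r′ with stuttering-response x y eq r g g′ r′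
    ...   | inj₁ r″   = inj₁ (refl , r″)
    ...   | inj₂ resp = inj₂ resp

    ∪-weakTransfer : WeakTransfer R → WeakTransfer R′ → WeakTransfer (R ∪ R′)
    ∪-weakTransfer wtr wtr′ (inj₁ r) st = WeakResponse-map inj₁ (wtr r st)
    ∪-weakTransfer wtr wtr′ (inj₂ r) st = WeakResponse-map inj₂ (wtr′ r st)

    lift-↠ : WeakTransfer R → R u t → _↠_ L u v → Σ State λ t′ → _↠_ L t t′ × R v t′
    lift-↠ wtr r ε = _ , ε , r
    lift-↠ wtr r (st ◅ p) with wtr r (step st)
    ... | _ , _ , _ , g , st′ , g′ , r′ with lift-↠ wtr r′ p
    ...   | t″ , q , r″ =
      t″ , GenSteps-path x g ◅◅ optional-τ⇒↠ st′ ◅◅ GenSteps-path y g′ ◅◅ q , r″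

    lift-↠* : WeakTransfer R → Star R u t → _↠_ L u v → Σ State λ t′ → _↠_ L t t′ × Star R v t′
    lift-↠* wtr ε p = _ , p , ε
    lift-↠* wtr (r ◅ rs) p with lift-↠ wtr r p
    ... | _ , q , r′ with lift-↠* wtr rs q
    ...   | t′ , q′ , rs′ = t′ , q′ , r′ ◅ rs′

    -- The induction is over the chain s R ⋯ R t, generalised over a τ-path s ↠ u: answering
    -- through the first link moves the state at the next link along a τ-path, not to itself.
    Star-response : WeakTransfer R → Star R s t → _↠_ L s u → u ─⟨ a ⟩→ u′ →
                    Σ State λ t₀ → _↠_ L t t₀ × WeakResponse (Star R) u t₀ a u′
    Star-response wtr ε p st = _ , p , immediate-response ε st ε
    Star-response wtr (r ◅ rs) p st with lift-↠ wtr r p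
    ... | _ , q , r₀ with wtr r₀ st
    ... | _ , _ , _ , g , st′ , g′ , r′ with Star-response wtr rs (q ◅◅ GenSteps-path x g) st′
    ... | t₀ , q₀ , (t₁ , t₂ , _ , h , st″ , h′ , e) with lift-↠* wtr e (GenSteps-path y g′)
    ... | t′ , q′ , e′ =
      t₀ , q₀ , t₁ , t₂ , t′ , GenSteps-reanchor-target x g h , st″ ,
      GenSteps-extend y (GenSteps-reanchor-source y g′ h′) q′ (r′ ◅ e′) , r′ ◅ e′

    Star-weakTransfer : WeakTransfer R → WeakTransfer (Star R)
    Star-weakTransfer wtr rs st with Star-response wtr rs ε st
    ... | _ , q , (t₁ , t₂ , t′ , g , st′ , g′ , e) =
      t₁ , t₂ , t′ , GenSteps-prepend x rs q g , st′ , g′ , e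

    Star-isGenericBisim : Symmetric R → WeakTransfer R → IsGenericBisim L x y (Star R)
    Star-isGenericBisim {R = R} sym wtr =
      reverse sym , WeakTransfer⇒Transfer isEquivalence (Star-weakTransfer wtr)
      where
        isEquivalence : IsEquivalence (Star R)
        isEquivalence = record { refl = ε ; sym = reverse sym ; trans = _◅◅_ }

    ≡-isGenericBisim : IsGenericBisim L x y _≡_
    ≡-isGenericBisim = ≡.sym , WeakTransfer⇒Transfer ≡.isEquivalence identity-weakTransfer
      where
        identity-weakTransfer : WeakTransfer _≡_
        identity-weakTransfer refl st = immediate-response refl st refl

    Star-∪-isGenericBisim : IsGenericBisim L x y R → IsGenericBisim L x y R′ →
                            IsGenericBisim L x y (Star (R ∪ R′))
    Star-∪-isGenericBisim {R = R} {R′ = R′} (sym , tr) (sym′ , tr′) =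
      Star-isGenericBisim (Union.symmetric {L = R} {R = R′} sym sym′)
        (∪-weakTransfer (Transfer⇒WeakTransfer tr) (Transfer⇒WeakTransfer tr′))

corollary4p7 : (L : LTS) (x y : Mode) → IsEquivalence (GenBisimilar L x y)
corollary4p7 L x y = record
  { refl  = _≡_ , ≡-isGenericBisim L x y , refl
  ; sym   = λ (R , (sym , tr) , r) → R , (sym , tr) , sym r
  ; trans = λ (R₁ , bisim₁ , r₁) (R₂ , bisim₂ , r₂) →
      Star (R₁ ∪ R₂) , Star-∪-isGenericBisim L x y bisim₁ bisim₂ , inj₁ r₁ ◅ inj₂ r₂ ◅ ε
  }
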